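{- Let $\sigma,\tau\in\mathfrak{S}_n$. Then $R(\sigma)=R(\tau)$ if and only if there is a permutation $\rho\in\mathfrak{S}_n$ that can be obtained both from $\sigma$ and from $\tau$ by finite sequences of legal moves. Equivalently, the relation $\sigma\sim\tau \iff R(\sigma)=R(\tau)$ is the equivalence relation on $\mathfrak{S}_n$ generated by legal moves.
   Context: Patience Sorting: given $\sigma=\sigma_1\cdots\sigma_n\in\mathfrak{S}_n$, process $\sigma_1,\dots,\sigma_n$ in order, maintaining a left-to-right sequence of piles; $\sigma_1$ starts the first pile; each subsequent card is placed on top of the leftmost pile whose current top card is larger than it, and if no such pile exists it starts a new pile to the right of all existing piles. $R(\sigma)$ denotes the resulting sequence of piles (each a set of cards). A legal move on $\pi\in\mathfrak{S}_n$ (changing an occurrence of $2\mathrm{ - }31$ not contained in an occurrence of $3\mathrm{ - }1\mathrm{ - }42$ into an occurrence of $2\mathrm{ - }13$, i.e. changing a $3\mathrm{ - }\bar{1}\mathrm{ - }42$ pattern into a $3\mathrm{ - }\bar{1}\mathrm{ - }24$ pattern): choose indices $i<j<n$ with $\pi_{j+1}<\pi_i<\pi_j$ such that there is no $k$ with $i<k<j$ and $\pi_k<\pi_{j+1}$, and swap the entries in positions $j$ and $j+1$. -}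

module Defs where

open import Data.Nat using (ℕ; _<_; _<ᵇ_)
open import Data.Bool using (if_then_else_)
open import Data.List using (List; []; _∷_; _++_; foldl)
open import Data.List.Relation.Unary.All using (All)
open import Relation.Nullary using (¬_)

-- Piles are stacks: a pile is a list whose head is its current top card.
Piles : Set
Piles = List (List ℕ)

place : ℕ → Piles → Piles
place x [] = (x ∷ []) ∷ []
place x ([] ∷ ps) = [] ∷ place x ps   -- never occurs (piles are nonempty)
place x ((t ∷ p) ∷ ps) =
  if x <ᵇ t then (x ∷ t ∷ p) ∷ ps else (t ∷ p) ∷ place x ps

R : List ℕ → Piles
R σ = foldl (λ ps x → place x ps) [] σ

-- One legal move: π = A ++ a ∷ B ++ b ∷ c ∷ C with c < a < b, where
-- a = π_i, b = π_j, c = π_{j+1}, B = entries strictly between positions i, j,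
-- and no entry of B is smaller than c; the move swaps b and c.
data Legal : List ℕ → List ℕ → Set where
  move : (A B C : List ℕ) (a b c : ℕ) →
         c < a → a < b → All (λ y → ¬ (y < c)) B →
         Legal (A ++ a ∷ B ++ b ∷ c ∷ C) (A ++ a ∷ B ++ c ∷ b ∷ C)

module Submission where

-- A legal move swaps adjacent cards b, c with c < a < b for an earlier card a, all cards
-- in between exceeding c. Once a is placed, the pile c would land on has top at most
-- a < b, and the intermediate cards (all larger than c) cannot change that; so b and c
-- go on different piles and placing them in either order gives the same piles.
-- Conversely, legal moves turn every permutation into the reading word of its piles:
-- inserting the next card x, which lands on a pile with top t, amounts to sliding x
-- leftwards past the cards of later piles, all larger than t, each slide being a legal
-- move with t as the 2 of 2-31. Permutations with equal piles thus reach the same word.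

open import Defs
open import Data.Nat using (ℕ; _<_; _≤_; _<ᵇ_)
open import Data.Nat.Properties
  using (<ᵇ-reflects-<; <-trans; ≤-trans; <⇒≤; <⇒≱; <-asym; ≮⇒≥; ≤∧≢⇒<; ≤-refl)
open import Data.Bool using (true; false)
open import Data.List using (List; []; _∷_; _++_; _ʳ++_; foldl; upTo)
open import Data.List.Properties using (++-assoc; ++-identityʳ; foldl-++)
open import Data.List.Relation.Unary.All using (All; []; _∷_; zipWith) renaming (map to All-map)
open import Data.List.Relation.Unary.All.Properties using (++⁺; ++⁻ʳ)
open import Data.List.Relation.Unary.AllPairs using (AllPairs; []; _∷_)
open import Data.List.Relation.Unary.Unique.Propositional using (Unique)
open import Data.List.Relation.Unary.Unique.Propositional.Properties using (upTo⁺)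
open import Data.List.Relation.Binary.Permutation.Propositional
  using (_↭_; ↭-refl; ↭-prep; ↭-swap; ↭-sym; ↭⇒↭ₛ)
open import Data.List.Relation.Binary.Permutation.Propositional.Properties using (++⁺ˡ)
open import Relation.Binary.PropositionalEquality
  using (_≡_; _≢_; refl; sym; trans; cong; subst; subst₂; setoid; module ≡-Reasoning)
open import Data.List.Relation.Binary.Permutation.Setoid.Properties (setoid ℕ) using (Unique-resp-↭)
open import Data.Product using (Σ; _×_; _,_; proj₁; proj₂)
open import Relation.Binary.Construct.Closure.ReflexiveTransitive using (Star; ε; _◅_; _◅◅_; gmap)
open import Function.Bundles using (_⇔_; mk⇔)
open import Relation.Nullary using (¬_)
open import Relation.Nullary.Reflects using (ofʸ; ofⁿ)
open import Data.Empty using (⊥-elim)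

placeAll : Piles → List ℕ → Piles
placeAll = foldl (λ ps x → place x ps)

place-< : ∀ {x t p ps} → x < t → place x ((t ∷ p) ∷ ps) ≡ (x ∷ t ∷ p) ∷ ps
place-< {x} {t} x<t with x <ᵇ t | <ᵇ-reflects-< x t
... | true  | _      = refl
... | false | ofⁿ x≮t = ⊥-elim (x≮t x<t)

place-≮ : ∀ {x t p ps} → ¬ x < t → place x ((t ∷ p) ∷ ps) ≡ (t ∷ p) ∷ place x ps
place-≮ {x} {t} x≮t with x <ᵇ t | <ᵇ-reflects-< x t
... | true  | ofʸ x<t = ⊥-elim (x≮t x<t)
... | false | _      = refl

Legal* : List ℕ → List ℕ → Set
Legal* = Star Legal

Legal⇒↭ : ∀ {u v} → Legal u v → u ↭ v
Legal⇒↭ (move A B C a b c _ _ _) = ++⁺ˡ A (↭-prep a (++⁺ˡ B (↭-swap b c ↭-refl)))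

Unique-resp-↭′ : ∀ {u v} → u ↭ v → Unique u → Unique v
Unique-resp-↭′ p = Unique-resp-↭ (↭⇒↭ₛ p)

Unique-resp-Legal* : ∀ {u v} → Legal* u v → Unique u → Unique v
Unique-resp-Legal* ε       u = u
Unique-resp-Legal* (l ◅ s) u = Unique-resp-Legal* s (Unique-resp-↭′ (Legal⇒↭ l) u)

AllPairs-++⁻ : ∀ {R : ℕ → ℕ → Set} xs {ys} → AllPairs R (xs ++ ys) →
               All (λ x → All (R x) ys) xs × AllPairs R ys
AllPairs-++⁻ []       rs       = [] , rs
AllPairs-++⁻ (x ∷ xs) (r ∷ rs) with AllPairs-++⁻ xs rs
... | rxs , rys = ++⁻ʳ xs r ∷ rxs , rys

-- The leftmost pile whose top exceeds c, i.e. the pile c would be placed on, has top at most a.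
data LandsAtMost (c a : ℕ) : Piles → Set where
  here  : ∀ {t p ps} → c < t → t ≤ a → LandsAtMost c a ((t ∷ p) ∷ ps)
  there : ∀ {t p ps} → ¬ c < t → LandsAtMost c a ps → LandsAtMost c a ((t ∷ p) ∷ ps)
  empty : ∀ {ps} → LandsAtMost c a ps → LandsAtMost c a ([] ∷ ps)

LandsAtMost-place : ∀ {c a} S → c < a → LandsAtMost c a (place a S)
LandsAtMost-place [] c<a = here c<a ≤-refl
LandsAtMost-place ([] ∷ ps) c<a = empty (LandsAtMost-place ps c<a)
LandsAtMost-place {c} {a} ((t ∷ p) ∷ ps) c<a with a <ᵇ t | <ᵇ-reflects-< a t
... | true  | _ = here c<a ≤-refl
... | false | ofⁿ a≮t with c <ᵇ t | <ᵇ-reflects-< c t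
...   | true  | ofʸ c<t = here c<t (≮⇒≥ a≮t)
...   | false | ofⁿ c≮t = there c≮t (LandsAtMost-place ps c<a)

LandsAtMost-place-above : ∀ {c a y} S → c < y → LandsAtMost c a S → LandsAtMost c a (place y S)
LandsAtMost-place-above ([] ∷ ps) c<y (empty l) = empty (LandsAtMost-place-above ps c<y l)
LandsAtMost-place-above {y = y} ((t ∷ p) ∷ ps) c<y l with y <ᵇ t | <ᵇ-reflects-< y t | l
... | true  | ofʸ y<t | here c<t t≤a  = here c<y (≤-trans (<⇒≤ y<t) t≤a)
... | true  | ofʸ y<t | there c≮t _   = ⊥-elim (c≮t (<-trans c<y y<t))
... | false | _       | here c<t t≤a  = here c<t t≤a
... | false | _       | there c≮t l′  = there c≮t (LandsAtMost-place-above ps c<y l′)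

LandsAtMost-placeAll : ∀ {c a} S B → All (c <_) B → LandsAtMost c a S → LandsAtMost c a (placeAll S B)
LandsAtMost-placeAll S []      []           l = l
LandsAtMost-placeAll S (y ∷ B) (c<y ∷ c<B) l =
  LandsAtMost-placeAll (place y S) B c<B (LandsAtMost-place-above S c<y l)

LandsAtMost-mono : ∀ {c a b S} → a ≤ b → LandsAtMost c a S → LandsAtMost c b S
LandsAtMost-mono a≤b (here c<t t≤a) = here c<t (≤-trans t≤a a≤b)
LandsAtMost-mono a≤b (there c≮t l)  = there c≮t (LandsAtMost-mono a≤b l)
LandsAtMost-mono a≤b (empty l)      = empty (LandsAtMost-mono a≤b l)

place-comm : ∀ {c b} S → c < b → LandsAtMost c b S → place c (place b S) ≡ place b (place c S)
place-comm ([] ∷ ps) c<b (empty l) = cong ([] ∷_) (place-comm ps c<b l)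
place-comm {c} {b} ((t ∷ p) ∷ ps) c<b (here c<t t≤b) = begin
  place c (place b ((t ∷ p) ∷ ps)) ≡⟨ cong (place c) (place-≮ b≮t) ⟩
  place c ((t ∷ p) ∷ place b ps)   ≡⟨ place-< c<t ⟩
  (c ∷ t ∷ p) ∷ place b ps         ≡⟨ place-≮ (<-asym c<b) ⟨
  place b ((c ∷ t ∷ p) ∷ ps)       ≡⟨ cong (place b) (place-< c<t) ⟨
  place b (place c ((t ∷ p) ∷ ps)) ∎
  where
  open ≡-Reasoning
  b≮t : ¬ b < t
  b≮t b<t = <⇒≱ b<t t≤b
place-comm {c} {b} ((t ∷ p) ∷ ps) c<b (there c≮t l) = begin
  place c (place b ((t ∷ p) ∷ ps))   ≡⟨ cong (place c) (place-≮ b≮t) ⟩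
  place c ((t ∷ p) ∷ place b ps)     ≡⟨ place-≮ c≮t ⟩
  (t ∷ p) ∷ place c (place b ps)     ≡⟨ cong ((t ∷ p) ∷_) (place-comm ps c<b l) ⟩
  (t ∷ p) ∷ place b (place c ps)     ≡⟨ place-≮ b≮t ⟨
  place b ((t ∷ p) ∷ place c ps)     ≡⟨ cong (place b) (place-≮ c≮t) ⟨
  place b (place c ((t ∷ p) ∷ ps))   ∎
  where
  open ≡-Reasoning
  b≮t : ¬ b < t
  b≮t b<t = c≮t (<-trans c<b b<t)

R-split : ∀ A a B x y C →
          R (A ++ a ∷ B ++ x ∷ y ∷ C) ≡ placeAll (place y (place x (placeAll (R A) (a ∷ B)))) C
R-split A a B x y C =
  trans (foldl-++ _ [] A (a ∷ B ++ x ∷ y ∷ C)) (foldl-++ _ (R A) (a ∷ B) (x ∷ y ∷ C))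

R-resp-Legal : ∀ {u v} → Unique u → Legal u v → R u ≡ R v
R-resp-Legal u! (move A B C a b c c<a a<b B≮c) = begin
  R (A ++ a ∷ B ++ b ∷ c ∷ C)               ≡⟨ R-split A a B b c C ⟩
  placeAll (place c (place b S)) C
    ≡⟨ cong (λ T → placeAll T C) (place-comm S (<-trans c<a a<b) c-lands) ⟩
  placeAll (place b (place c S)) C          ≡⟨ R-split A a B c b C ⟨
  R (A ++ a ∷ B ++ c ∷ b ∷ C)               ∎
  where
  open ≡-Reasoning
  S : Piles
  S = placeAll (R A) (a ∷ B)
  B≢c : All (λ y → All (y ≢_) (b ∷ c ∷ C)) B
  B≢c with proj₂ (AllPairs-++⁻ A u!)
  ... | _ ∷ rest = proj₁ (AllPairs-++⁻ B rest)
  c<B : All (c <_) B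
  c<B = zipWith (λ { (y≮c , _ ∷ y≢c ∷ _) → ≤∧≢⇒< (≮⇒≥ y≮c) (λ c≡y → y≢c (sym c≡y)) }) (B≮c , B≢c)
  c-lands : LandsAtMost c b S
  c-lands = LandsAtMost-mono (<⇒≤ a<b)
    (LandsAtMost-placeAll (place a (R A)) B c<B (LandsAtMost-place (R A) c<a))

R-resp-Legal* : ∀ {u v} → Unique u → Legal* u v → R u ≡ R v
R-resp-Legal* u! ε       = refl
R-resp-Legal* u! (l ◅ s) = trans (R-resp-Legal u! l) (R-resp-Legal* (Unique-resp-Legal* (l ◅ ε) u!) s)

module _ {P : ℕ → Set} where

  All-ʳ++⁺ : ∀ {xs ys} → All P xs → All P ys → All P (xs ʳ++ ys)
  All-ʳ++⁺ []         pys = pys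
  All-ʳ++⁺ (px ∷ pxs) pys = All-ʳ++⁺ pxs (px ∷ pys)

  All-ʳ++⁻ : ∀ xs {ys} → All P (xs ʳ++ ys) → All P xs × All P ys
  All-ʳ++⁻ []       pys = [] , pys
  All-ʳ++⁻ (x ∷ xs) h with All-ʳ++⁻ xs h
  ... | pxs , px ∷ pys = px ∷ pxs , pys

ʳ++-++ : ∀ (xs : List ℕ) {ys zs} → (xs ʳ++ ys) ++ zs ≡ xs ʳ++ (ys ++ zs)
ʳ++-++ []       = refl
ʳ++-++ (x ∷ xs) = ʳ++-++ xs

reading : Piles → List ℕ
reading []       = []
reading (p ∷ ps) = p ʳ++ reading ps

data Stacked : Piles → Set where
  []    : Stacked []
  empty : ∀ {ps} → Stacked ps → Stacked ([] ∷ ps)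
  pile  : ∀ {t p ps} → All (t <_) (reading ps) → Stacked ps → Stacked ((t ∷ p) ∷ ps)

All-reading-place : ∀ {P : ℕ → Set} {x} ps → All P (reading ps) → P x → All P (reading (place x ps))
All-reading-place [] _ px = px ∷ []
All-reading-place ([] ∷ ps) h px = All-reading-place ps h px
All-reading-place {x = x} ((t ∷ p) ∷ ps) h px with x <ᵇ t | All-ʳ++⁻ p h
... | true  | hp , pt ∷ hps = All-ʳ++⁺ hp (pt ∷ px ∷ hps)
... | false | hp , pt ∷ hps = All-ʳ++⁺ hp (pt ∷ All-reading-place ps hps px)

Stacked-place : ∀ {x} P → Stacked P → All (_≢ x) (reading P) → Stacked (place x P)
Stacked-place [] [] _ = pile [] []
Stacked-place ([] ∷ ps) (empty s) x∉ = empty (Stacked-place ps s x∉)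
Stacked-place {x} ((t ∷ p) ∷ ps) (pile t<ps s) x∉ with x <ᵇ t | <ᵇ-reflects-< x t | All-ʳ++⁻ p x∉
... | true  | ofʸ x<t | _ = pile (All-map (<-trans x<t) t<ps) s
... | false | ofⁿ x≮t | _ , t≢x ∷ x∉ps =
  pile (All-reading-place ps t<ps (≤∧≢⇒< (≮⇒≥ x≮t) t≢x)) (Stacked-place ps s x∉ps)

Legal-ʳ++ : ∀ D {u v} → Legal u v → Legal (D ʳ++ u) (D ʳ++ v)
Legal-ʳ++ []      l = l
Legal-ʳ++ (d ∷ D) (move A B C a b c c<a a<b B≮c) = Legal-ʳ++ D (move (d ∷ A) B C a b c c<a a<b B≮c)

Legal*-ʳ++ : ∀ D {u v} → Legal* u v → Legal* (D ʳ++ u) (D ʳ++ v)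
Legal*-ʳ++ D = gmap (D ʳ++_) (Legal-ʳ++ D)

slide : ∀ {a x C} B L → x < a → All (a <_) B → All (a <_) L →
        Legal* (a ∷ B ++ L ++ x ∷ C) (a ∷ B ++ x ∷ L ++ C)
slide B [] x<a a<B [] = ε
slide {a} {x} {C} B (b ∷ L) x<a a<B (a<b ∷ a<L) =
  subst₂ Legal* (shift (L ++ x ∷ C)) (shift (x ∷ L ++ C)) (slide (B ++ b ∷ []) L x<a (++⁺ a<B (a<b ∷ [])) a<L)
  ◅◅ move [] B (L ++ C) a b x x<a a<b (All-map (λ a<y → <-asym (<-trans x<a a<y)) a<B) ◅ ε
  where
  shift : ∀ ys → a ∷ (B ++ b ∷ []) ++ ys ≡ a ∷ B ++ b ∷ ys
  shift ys = cong (a ∷_) (++-assoc B (b ∷ []) ys)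

reading-place : ∀ {x} P C → Stacked P → Legal* (reading P ++ x ∷ C) (reading (place x P) ++ C)
reading-place [] C [] = ε
reading-place ([] ∷ ps) C (empty s) = reading-place ps C s
reading-place {x} ((t ∷ p) ∷ ps) C (pile t<ps s) with x <ᵇ t | <ᵇ-reflects-< x t
... | true  | ofʸ x<t =
  subst₂ Legal* (sym (ʳ++-++ p)) (sym (ʳ++-++ p)) (Legal*-ʳ++ p (slide [] (reading ps) x<t [] t<ps))
... | false | _ =
  subst₂ Legal* (sym (ʳ++-++ p)) (sym (ʳ++-++ p)) (Legal*-ʳ++ (t ∷ p) (reading-place ps C s))

reading-placeAll : ∀ xs P → Stacked P → Unique (reading P ++ xs) → Legal* (reading P ++ xs) (reading (placeAll P xs))
reading-placeAll [] P s _ = subst (λ w → Legal* w (reading P)) (sym (++-identityʳ (reading P))) ε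
reading-placeAll (x ∷ xs) P s u! =
  step ◅◅ reading-placeAll xs (place x P) (Stacked-place P s x∉P) (Unique-resp-Legal* step u!)
  where
  step : Legal* (reading P ++ x ∷ xs) (reading (place x P) ++ xs)
  step = reading-place P xs s
  x∉P : All (_≢ x) (reading P)
  x∉P = All-map (λ { (y≢x ∷ _) → y≢x }) (proj₁ (AllPairs-++⁻ (reading P) u!))

Legal*-reading-R : ∀ σ → Unique σ → Legal* σ (reading (R σ))
Legal*-reading-R σ = reading-placeAll σ [] []

mainTheorem2 : (n : ℕ) (σ τ : List ℕ) → σ ↭ upTo n → τ ↭ upTo n →
    (R σ ≡ R τ) ⇔ Σ (List ℕ) (λ ρ → Star Legal σ ρ × Star Legal τ ρ)
mainTheorem2 n σ τ σ↭ τ↭ = mk⇔ common-reading same-piles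
  where
  σ! : Unique σ
  σ! = Unique-resp-↭′ (↭-sym σ↭) (upTo⁺ n)
  τ! : Unique τ
  τ! = Unique-resp-↭′ (↭-sym τ↭) (upTo⁺ n)
  common-reading : R σ ≡ R τ → Σ (List ℕ) (λ ρ → Legal* σ ρ × Legal* τ ρ)
  common-reading Rσ≡Rτ =
    reading (R σ) , Legal*-reading-R σ σ! , subst (λ S → Legal* τ (reading S)) (sym Rσ≡Rτ) (Legal*-reading-R τ τ!)
  same-piles : Σ (List ℕ) (λ ρ → Legal* σ ρ × Legal* τ ρ) → R σ ≡ R τ
  same-piles (ρ , σ⇝ρ , τ⇝ρ) = trans (R-resp-Legal* σ! σ⇝ρ) (sym (R-resp-Legal* τ! τ⇝ρ))
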